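{- Let $G$ be a connected simple graph of order $n$. If $\lambda(G)=3$ and there exists a vertex $u\in V(G)$ with $d_G(u)=n-1$, then $\lambda_k(G)\geq 2$ for every integer $k$ with $3\leq k\leq n$.
   Context: All graphs are finite, simple and undirected. $\lambda(G)$ is the edge-connectivity of $G$. For a graph $G$ and a vertex set $S\subseteq V(G)$ with $|S|\ge 2$, an $S$-Steiner tree is a subgraph of $G$ which is a tree and contains every vertex of $S$. $\lambda(S)$ denotes the maximum number of pairwise edge-disjoint $S$-Steiner trees in $G$. For an integer $k$ with $2\le k\le |V(G)|$, the generalized $k$-edge-connectivity is $\lambda_k(G)=\min\{\lambda(S): S\subseteq V(G),\ |S|=k\}$, with the convention $\lambda_k(G)=0$ if $G$ is disconnected. -}

module Defs where

open import Data.Nat using (ℕ; zero; suc; _+_; _∸_; _≤_; _<_; _<ᵇ_)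
open import Data.Bool using (Bool; true; false; _∧_; not; if_then_else_)
open import Data.Fin using (Fin; toℕ)
open import Data.Fin.Subset using (Subset; _∈_; _⊆_)
open import Data.List using (List; map; allFin)
open import Data.Nat.ListAction using (sum)
open import Data.Product using (Σ; _×_; ∃)
open import Relation.Binary.PropositionalEquality using (_≡_; _≢_)
open import Relation.Nullary using (¬_)

record Graph (n : ℕ) : Set where
  field
    adj    : Fin n → Fin n → Bool
    sym    : ∀ i j → adj i j ≡ adj j i
    irrefl : ∀ i → adj i i ≡ false
open Graph public

count : ∀ {n} → (Fin n → Bool) → ℕ
count {n} p = sum (map (λ i → if p i then 1 else 0) (allFin n))

degree : ∀ {n} → Graph n → Fin n → ℕ
degree G u = count (adj G u)

EdgeRel : ℕ → Set
EdgeRel n = Fin n → Fin n → Bool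

edgeCount : ∀ {n} → EdgeRel n → ℕ
edgeCount {n} F = sum (map (λ i → count (λ j → F i j ∧ (toℕ i <ᵇ toℕ j))) (allFin n))

data Reach {n : ℕ} (E : EdgeRel n) : Fin n → Fin n → Set where
  here : ∀ {u} → Reach E u u
  step : ∀ {u v w} → E u v ≡ true → Reach E v w → Reach E u w

ConnectedE : ∀ {n} → EdgeRel n → Set
ConnectedE {n} E = ∀ (u v : Fin n) → Reach E u v

Connected : ∀ {n} → Graph n → Set
Connected G = ConnectedE (adj G)

IsEdgeSet : ∀ {n} → Graph n → EdgeRel n → Set
IsEdgeSet G F = (∀ i j → F i j ≡ F j i) × (∀ i j → F i j ≡ true → adj G i j ≡ true)

removeEdges : ∀ {n} → Graph n → EdgeRel n → EdgeRel n
removeEdges G F i j = adj G i j ∧ not (F i j)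

EdgeConnectivityIs : ∀ {n} → Graph n → ℕ → Set
EdgeConnectivityIs G l =
  (∀ F → IsEdgeSet G F → edgeCount F < l → ConnectedE (removeEdges G F)) ×
  (Σ (EdgeRel _) λ F → IsEdgeSet G F × edgeCount F ≡ l × ¬ ConnectedE (removeEdges G F))

HasCycle : ∀ {n} → EdgeRel n → Set
HasCycle {n} E =
  Σ ℕ λ m → 3 ≤ m × Σ (ℕ → Fin n) λ c →
    (∀ i j → i < m → j < m → c i ≡ c j → i ≡ j) ×
    (∀ i → suc i < m → E (c i) (c (suc i)) ≡ true) ×
    E (c (m ∸ 1)) (c 0) ≡ true

record SteinerTree {n : ℕ} (G : Graph n) (S : Subset n) : Set where
  field
    V       : Subset n
    E       : EdgeRel n
    E-sym   : ∀ i j → E i j ≡ E j i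
    E⊆G     : ∀ i j → E i j ≡ true → adj G i j ≡ true
    E-endsˡ : ∀ i j → E i j ≡ true → i ∈ V
    S⊆V     : S ⊆ V
    conn    : ∀ u v → u ∈ V → v ∈ V → Reach E u v
    acyclic : ¬ HasCycle E
open SteinerTree public

EdgeDisjoint : ∀ {n} {G : Graph n} {S : Subset n} → SteinerTree G S → SteinerTree G S → Set
EdgeDisjoint T₁ T₂ = ∀ i j → E T₁ i j ≡ true → E T₂ i j ≡ false

SteinerPackingAtLeast : ∀ {n} → Graph n → Subset n → ℕ → Set
SteinerPackingAtLeast G S m =
  Σ (Fin m → SteinerTree G S) λ T → ∀ a b → a ≢ b → EdgeDisjoint (T a) (T b)

GenEdgeConnAtLeast : ∀ {n} → Graph n → ℕ → ℕ → Set
GenEdgeConnAtLeast {n} G k m =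
  Connected G × (∀ (S : Subset n) → Data.Fin.Subset.∣ S ∣ ≡ k → SteinerPackingAtLeast G S m)

module Submission where

-- Both trees span G, so they serve every S at once. The first is the star at the universal
-- vertex u, except that some vertices x are rerouted: their star edge xu is replaced by an
-- edge x (target x). The second grows from u inside G minus the first: an unreached vertex is
-- attached to a reached neighbour other than u whenever there is one. Otherwise, since
-- λ(G) = 3 gives every vertex v ≠ u two neighbours besides u, the unreached vertices span a
-- subgraph of minimum degree two and hence contain a cycle c₀ c₁ … c₀. Rerouting c₁ to c₀
-- frees the edge u c₁, and the second tree absorbs the whole cycle along u c₁ c₂ … c₀.

open import Defs hiding (sym)
open import Data.Bool using (Bool; true; false; _∧_; _∨_; not; if_then_else_; T)
  renaming (_≟_ to _≟ᵇ_)
open import Data.Bool.Properties using (¬-not; ∨-zeroʳ; ∨-identityʳ; ∨-comm)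
open import Data.Empty using (⊥; ⊥-elim)
open import Data.Fin using (Fin; zero; suc; toℕ; _≟_)
open import Data.Fin.Properties using (suc-injective; any?; pigeonhole)
open import Data.Fin.Subset using (Subset; ⊤)
open import Data.Fin.Subset.Properties using (∈⊤)
open import Data.List using (map; allFin)
open import Data.List.Properties using (map-tabulate; map-cong)
open import Data.Nat using (ℕ; zero; suc; _+_; _∸_; _≤_; _<_; z≤n; s≤s; z<s; s≤s⁻¹; _<ᵇ_; _≤?_; _<?_)
open import Data.Nat.Induction using (<-wellFounded)
open import Data.Nat.ListAction using (sum)
open import Data.Nat.Properties
  using ( ≤-refl; ≤-trans; ≤-reflexive; ≤-antisym; <-trans; <-asym; <-irrefl; <-cmp; <⇒≤; <⇒≢; <⇒≱
        ; ≮⇒≥; ≰⇒≥; n≮0; n<1+n; m<n⇒m<1+n; m≤n⇒m≤1+n; m<1+n⇒m≤n; m≤n⇒m<n∨m≡n; <ᵇ⇒<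
        ; +-comm; +-suc; +-identityʳ; +-mono-≤; +-mono-≤-<; +-mono-<-≤; +-monoʳ-<; +-monoʳ-≤
        ; m≤m+n; m≤n+m; m<m+n; m+[n∸m]≡n; anyUpTo?; +-commutativeSemigroup; module ≤-Reasoning )
open import Data.Product using (Σ; _×_; _,_; proj₁; proj₂; ∃)
open import Data.Sum using (_⊎_; inj₁; inj₂; [_,_]′) renaming (map to ⊎-map)
open import Data.Unit using (tt)
open import Function using (_∘_; id; case_of_)
open import Induction.WellFounded using (Acc; acc)
open import Relation.Binary.Definitions using (tri<; tri≈; tri>)
open import Relation.Binary.PropositionalEquality
open import Relation.Nullary using (¬_; Dec; does; yes; no)
open import Relation.Nullary.Decidable using (dec-true; dec-false; _×-dec_; ¬?)

_==_ : ∀ {n} → Fin n → Fin n → Bool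
i == j = does (i ≟ j)

==-refl : ∀ {n} (i : Fin n) → (i == i) ≡ true
==-refl i = dec-true (i ≟ i) refl

==-≢ : ∀ {n} {i j : Fin n} → i ≢ j → (i == j) ≡ false
==-≢ {i = i} {j} = dec-false (i ≟ j)

==⇒≡ : ∀ {n} {i j : Fin n} → (i == j) ≡ true → i ≡ j
==⇒≡ {i = i} {j} e with i ≟ j | e
... | yes i≡j | _ = i≡j
... | no _ | ()

∧-true : ∀ {a b} → a ∧ b ≡ true → a ≡ true × b ≡ true
∧-true {true} {true} _ = refl , refl

∨-true : ∀ {a b} → a ∨ b ≡ true → a ≡ true ⊎ b ≡ true
∨-true {true} _ = inj₁ refl
∨-true {false} b≡true = inj₂ b≡true

∨-introˡ : ∀ {a} b → a ≡ true → a ∨ b ≡ true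
∨-introˡ b refl = refl

∨-introʳ : ∀ a {b} → b ≡ true → a ∨ b ≡ true
∨-introʳ a refl = ∨-zeroʳ a

∨-false-elim : ∀ {a} → a ∨ false ≡ true → a ≡ true
∨-false-elim {true} _ = refl

∨-false : ∀ {a b} → a ≡ false → b ≡ false → a ∨ b ≡ false
∨-false refl refl = refl

not-true : ∀ {b} → not b ≡ true → b ≡ false
not-true {false} _ = refl

true≢false : ∀ {b} → b ≡ true → b ≡ false → ⊥
true≢false refl ()

true-false⇒≢ : ∀ {A : Set} {P : A → Bool} {a b} → P a ≡ true → P b ≡ false → a ≢ b
true-false⇒≢ Pa Pb refl = true≢false Pa Pb

-- Finite sums and counting

∑ : ∀ {n} → (Fin n → ℕ) → ℕ
∑ {n} f = sum (map f (allFin n))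

∑-suc : ∀ {n} (f : Fin (suc n) → ℕ) → ∑ f ≡ f zero + ∑ (f ∘ suc)
∑-suc {n} f = cong (λ xs → f zero + sum xs)
  (trans (map-tabulate suc f) (sym (map-tabulate id (f ∘ suc))))

∑-mono : ∀ {n} {f g : Fin n → ℕ} → (∀ i → f i ≤ g i) → ∑ f ≤ ∑ g
∑-mono {zero} f≤g = z≤n
∑-mono {suc n} {f} {g} f≤g = begin
  ∑ f                   ≡⟨ ∑-suc f ⟩
  f zero + ∑ (f ∘ suc)  ≤⟨ +-mono-≤ (f≤g zero) (∑-mono (f≤g ∘ suc)) ⟩
  g zero + ∑ (g ∘ suc)  ≡⟨ ∑-suc g ⟨
  ∑ g                   ∎
  where open ≤-Reasoning

∑-mono-< : ∀ {n} {f g : Fin n → ℕ} → (∀ i → f i ≤ g i) → ∀ w → f w < g w → ∑ f < ∑ g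
∑-mono-< {suc n} {f} {g} f≤g w fw<gw = begin-strict
  ∑ f                   ≡⟨ ∑-suc f ⟩
  f zero + ∑ (f ∘ suc)  <⟨ split w fw<gw ⟩
  g zero + ∑ (g ∘ suc)  ≡⟨ ∑-suc g ⟨
  ∑ g                   ∎
  where
  open ≤-Reasoning
  split : ∀ w → f w < g w → f zero + ∑ (f ∘ suc) < g zero + ∑ (g ∘ suc)
  split zero    f0<g0 = +-mono-<-≤ f0<g0 (∑-mono (f≤g ∘ suc))
  split (suc w) fw<gw = +-mono-≤-< (f≤g zero) (∑-mono-< (f≤g ∘ suc) w fw<gw)

∑-+ : ∀ {n} (f g : Fin n → ℕ) → ∑ (λ i → f i + g i) ≡ ∑ f + ∑ g
∑-+ {zero} f g = refl
∑-+ {suc n} f g = begin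
  ∑ (λ i → f i + g i)
    ≡⟨ ∑-suc (λ i → f i + g i) ⟩
  (f zero + g zero) + ∑ (λ i → f (suc i) + g (suc i))
    ≡⟨ cong (f zero + g zero +_) (∑-+ (f ∘ suc) (g ∘ suc)) ⟩
  (f zero + g zero) + (∑ (f ∘ suc) + ∑ (g ∘ suc))
    ≡⟨ interchange (f zero) (g zero) (∑ (f ∘ suc)) (∑ (g ∘ suc)) ⟩
  (f zero + ∑ (f ∘ suc)) + (g zero + ∑ (g ∘ suc))
    ≡⟨ cong₂ _+_ (∑-suc f) (∑-suc g) ⟨
  ∑ f + ∑ g
    ∎
  where
  open ≡-Reasoning
  open import Algebra.Properties.CommutativeSemigroup +-commutativeSemigroup using (interchange)

∑-zero : ∀ {n} (f : Fin n → ℕ) → (∀ i → f i ≡ 0) → ∑ f ≡ 0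
∑-zero {zero} f f≡0 = refl
∑-zero {suc n} f f≡0 = trans (∑-suc f) (cong₂ _+_ (f≡0 zero) (∑-zero (f ∘ suc) (f≡0 ∘ suc)))

∑-cong : ∀ {n} {f g : Fin n → ℕ} → (∀ i → f i ≡ g i) → ∑ f ≡ ∑ g
∑-cong {n} f≗g = cong sum (map-cong f≗g (allFin n))

∑-single : ∀ {n} (f : Fin n → ℕ) v → (∀ i → i ≢ v → f i ≡ 0) → ∑ f ≡ f v
∑-single {suc n} f zero    f≡0 = begin
  ∑ f                   ≡⟨ ∑-suc f ⟩
  f zero + ∑ (f ∘ suc)  ≡⟨ cong (f zero +_) (∑-zero (f ∘ suc) λ i → f≡0 (suc i) λ ()) ⟩
  f zero + 0            ≡⟨ +-identityʳ (f zero) ⟩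
  f zero                ∎
  where open ≡-Reasoning
∑-single {suc n} f (suc v) f≡0 = begin
  ∑ f                   ≡⟨ ∑-suc f ⟩
  f zero + ∑ (f ∘ suc)  ≡⟨ cong₂ _+_ (f≡0 zero λ ()) (∑-single (f ∘ suc) v λ i → f≡0 (suc i) ∘ (_∘ suc-injective)) ⟩
  f (suc v)             ∎
  where open ≡-Reasoning

indicator : Bool → ℕ
indicator b = if b then 1 else 0

indicator-mono : ∀ {a b} → (a ≡ true → b ≡ true) → indicator a ≤ indicator b
indicator-mono {false} _ = z≤n
indicator-mono {true} a⇒b rewrite a⇒b refl = ≤-refl

count-mono : ∀ {n} {p q : Fin n → Bool} → (∀ i → p i ≡ true → q i ≡ true) → count p ≤ count q
count-mono p⇒q = ∑-mono λ i → indicator-mono (p⇒q i)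

count-mono-< : ∀ {n} {p q : Fin n → Bool} → (∀ i → p i ≡ true → q i ≡ true) →
  ∀ w → p w ≡ false → q w ≡ true → count p < count q
count-mono-< p⇒q w pw qw = ∑-mono-< (λ i → indicator-mono (p⇒q i)) w
  (subst₂ (λ a b → indicator a < indicator b) (sym pw) (sym qw) ≤-refl)

count-complement : ∀ {n} (p : Fin n → Bool) → count p + count (not ∘ p) ≡ n
count-complement {n} p = begin
  count p + count (not ∘ p)                         ≡⟨ ∑-+ (indicator ∘ p) (indicator ∘ not ∘ p) ⟨
  ∑ (λ i → indicator (p i) + indicator (not (p i))) ≡⟨ ∑-cong (λ i → one (p i)) ⟩
  ∑ {n} (λ _ → 1)                                   ≡⟨ ∑-one n ⟩
  n                                                 ∎
  where
  open ≡-Reasoning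
  one : ∀ b → indicator b + indicator (not b) ≡ 1
  one true  = refl
  one false = refl
  ∑-one : ∀ n → ∑ {n} (λ _ → 1) ≡ n
  ∑-one zero    = refl
  ∑-one (suc n) = trans (∑-suc {n} (λ _ → 1)) (cong suc (∑-one n))

count≤n : ∀ {n} (p : Fin n → Bool) → count p ≤ n
count≤n p = ≤-trans (m≤m+n (count p) _) (≤-reflexive (count-complement p))

count-at-most-one : ∀ {n} (p : Fin n → Bool) v → (∀ i → p i ≡ true → i ≡ v) →
  count p ≡ indicator (p v)
count-at-most-one p v only-v =
  ∑-single (indicator ∘ p) v λ i i≢v → cong indicator (¬-not λ pi → i≢v (only-v i pi))

count-== : ∀ {n} (v : Fin n) → count (_== v) ≡ 1
count-== v = trans (count-at-most-one (_== v) v (λ i → ==⇒≡)) (cong indicator (==-refl v))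

count-≢ : ∀ {n} (v : Fin n) → count (not ∘ (_== v)) ≡ n ∸ 1
count-≢ v = cong (_∸ 1) (trans (cong (_+ count (not ∘ (_== v))) (sym (count-== v))) (count-complement (_== v)))

count-∨ : ∀ {n} (p q : Fin n → Bool) → count (λ i → p i ∨ q i) ≤ count p + count q
count-∨ p q = ≤-trans (∑-mono λ i → split (p i) (q i))
  (≤-reflexive (∑-+ (indicator ∘ p) (indicator ∘ q)))
  where
  split : ∀ a b → indicator (a ∨ b) ≤ indicator a + indicator b
  split true  _ = s≤s z≤n
  split false _ = ≤-refl

<ᵇ-asym : ∀ m n → (m <ᵇ n) ≡ true → (n <ᵇ m) ≡ true → ⊥
<ᵇ-asym m n m<n n<m = <-asym (<ᵇ⇒< m n (≡true⇒T m<n)) (<ᵇ⇒< n m (≡true⇒T n<m))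
  where
  ≡true⇒T : ∀ {b} → b ≡ true → T b
  ≡true⇒T refl = tt

-- Row i of edgeCount counts the edges ij with i < j; every row but row v holds at most the edge iv.
edgeCount-star : ∀ {n} (F : EdgeRel n) v → (∀ i j → F i j ≡ F j i) →
  (∀ i j → F i j ≡ true → i ≡ v ⊎ j ≡ v) → edgeCount F ≤ count (F v)
edgeCount-star {n} F v F-sym at-v = begin
  ∑ row                                                 ≤⟨ ∑-mono row-bound ⟩
  ∑ (λ i → below i + (if i == v then row i else 0))     ≡⟨ ∑-+ below _ ⟩
  ∑ below + ∑ (λ i → if i == v then row i else 0)       ≡⟨ cong (∑ below +_) (∑-single _ v off-v) ⟩
  ∑ below + (if v == v then row v else 0)               ≡⟨ cong (λ b → ∑ below + (if b then row v else 0))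
                                                                (==-refl v) ⟩
  ∑ below + ∑ above                                     ≡⟨ ∑-+ below above ⟨
  ∑ (λ i → below i + above i)                           ≤⟨ ∑-mono below+above≤ ⟩
  count (F v)                                           ∎
  where
  open ≤-Reasoning
  row below above : Fin n → ℕ
  row i = count (λ j → F i j ∧ (toℕ i <ᵇ toℕ j))
  below i = indicator (F v i ∧ (toℕ i <ᵇ toℕ v))
  above i = indicator (F v i ∧ (toℕ v <ᵇ toℕ i))

  row-bound : ∀ i → row i ≤ below i + (if i == v then row i else 0)
  row-bound i with i ≟ v
  ... | yes refl = m≤n+m (row v) (below v)
  ... | no i≢v = begin
    row i                                   ≡⟨ count-at-most-one _ v only-v ⟩
    indicator (F i v ∧ (toℕ i <ᵇ toℕ v))    ≡⟨ cong (λ b → indicator (b ∧ _)) (F-sym i v) ⟩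
    below i                                 ≤⟨ m≤m+n (below i) 0 ⟩
    below i + 0                             ∎
    where
    only-v : ∀ j → F i j ∧ (toℕ i <ᵇ toℕ j) ≡ true → j ≡ v
    only-v j Fij with at-v i j (proj₁ (∧-true Fij))
    ... | inj₁ i≡v = ⊥-elim (i≢v i≡v)
    ... | inj₂ j≡v = j≡v

  off-v : ∀ i → i ≢ v → (if i == v then row i else 0) ≡ 0
  off-v i i≢v = cong (λ b → if b then row i else 0) (==-≢ i≢v)

  exclusive : ∀ a x y → (x ≡ true → y ≡ true → ⊥) →
    indicator (a ∧ x) + indicator (a ∧ y) ≤ indicator a
  exclusive false _     _     _   = z≤n
  exclusive true  false false _   = z≤n
  exclusive true  false true  _   = ≤-refl
  exclusive true  true  false _   = ≤-refl
  exclusive true  true  true  x⊥y = ⊥-elim (x⊥y refl refl)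

  below+above≤ : ∀ i → below i + above i ≤ indicator (F v i)
  below+above≤ i = exclusive (F v i) (toℕ i <ᵇ toℕ v) (toℕ v <ᵇ toℕ i) (<ᵇ-asym (toℕ i) (toℕ v))

module _ {n} (G : Graph n) where

  degree≡n∸1⇒adj : ∀ u → degree G u ≡ n ∸ 1 → ∀ v → v ≢ u → adj G u v ≡ true
  degree≡n∸1⇒adj u deg v v≢u = ¬-not λ u≁v → <-irrefl refl (begin-strict
    n ∸ 1                   ≡⟨ deg ⟨
    count (adj G u)         <⟨ count-mono-< loopless v u≁v (cong not (==-≢ v≢u)) ⟩
    count (not ∘ (_== u))   ≡⟨ count-≢ u ⟩
    n ∸ 1                   ∎)
    where
    open ≤-Reasoning
    loopless : ∀ j → adj G u j ≡ true → not (j == u) ≡ true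
    loopless j u~j = cong not (==-≢ j≢u)
      where
      j≢u : j ≢ u
      j≢u refl = true≢false u~j (irrefl G u)

  incident : Fin n → EdgeRel n
  incident v i j = (i == v ∨ j == v) ∧ adj G i j

  incident-isEdgeSet : ∀ v → IsEdgeSet G (incident v)
  incident-isEdgeSet v = incident-sym , λ i j e → proj₂ (∧-true e)
    where
    incident-sym : ∀ i j → incident v i j ≡ incident v j i
    incident-sym i j rewrite Graph.sym G i j | ∨-comm (i == v) (j == v) = refl

  incident-at : ∀ v j → incident v v j ≡ adj G v j
  incident-at v j rewrite ==-refl v = refl

  edgeCount-incident : ∀ v → edgeCount (incident v) ≤ degree G v
  edgeCount-incident v = ≤-trans
    (edgeCount-star (incident v) v (proj₁ (incident-isEdgeSet v)) ends)
    (≤-reflexive (∑-cong λ j → cong indicator (incident-at v j)))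
    where
    ends : ∀ i j → incident v i j ≡ true → i ≡ v ⊎ j ≡ v
    ends i j e with ∨-true (proj₁ (∧-true e))
    ... | inj₁ i==v = inj₁ (==⇒≡ i==v)
    ... | inj₂ j==v = inj₂ (==⇒≡ j==v)

  isolated-by-incident : ∀ v w → v ≢ w → ¬ Reach (removeEdges G (incident v)) v w
  isolated-by-incident v w v≢w here = v≢w refl
  isolated-by-incident v w v≢w (step {v = x} e _) rewrite incident-at v x with adj G v x
  ... | true  = case e of λ ()
  ... | false = case e of λ ()

  -- If all neighbours of v lie in {a, b}, deleting the at most two edges at v isolates v.
  neighbour-avoiding : (∀ F → IsEdgeSet G F → edgeCount F < 3 → ConnectedE (removeEdges G F)) →
    ∀ v a b → v ≢ a → ∃ λ j → adj G v j ≡ true × j ≢ a × j ≢ b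
  neighbour-avoiding λ≥3 v a b v≢a
    with any? (λ j → (adj G v j ≟ᵇ true) ×-dec ¬? (j ≟ a) ×-dec ¬? (j ≟ b))
  ... | yes found = found
  ... | no none = ⊥-elim (isolated-by-incident v a v≢a
          (λ≥3 (incident v) (incident-isEdgeSet v) small v a))
    where
    within-ab : ∀ j → adj G v j ≡ true → (j == a ∨ j == b) ≡ true
    within-ab j v~j with j ≟ a | j ≟ b
    ... | yes _   | _       = refl
    ... | no _    | yes _   = refl
    ... | no j≢a  | no j≢b  = ⊥-elim (none (j , v~j , j≢a , j≢b))
    small : edgeCount (incident v) < 3
    small = s≤s (begin
      edgeCount (incident v)                  ≤⟨ edgeCount-incident v ⟩
      count (adj G v)                         ≤⟨ count-mono within-ab ⟩
      count (λ j → j == a ∨ j == b)           ≤⟨ count-∨ (_== a) (_== b) ⟩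
      count (_== a) + count (_== b)           ≡⟨ cong₂ _+_ (count-== a) (count-== b) ⟩
      2                                       ∎)
      where open ≤-Reasoning

-- Rooted trees

Reach-++ : ∀ {n} {E : EdgeRel n} {a b c} → Reach E a b → Reach E b c → Reach E a c
Reach-++ here         q = q
Reach-++ (step e p) q = step e (Reach-++ p q)

Reach-reverse : ∀ {n} {E : EdgeRel n} → (∀ i j → E i j ≡ E j i) → ∀ {a b} → Reach E a b → Reach E b a
Reach-reverse E-sym here = here
Reach-reverse E-sym {a} (step {v = v} e p) =
  Reach-++ (Reach-reverse E-sym p) (step (trans (E-sym v a) e) here)

argmax : ∀ m (f : ℕ → ℕ) → ∃ λ t → t ≤ m × (∀ s → s ≤ m → f s ≤ f t)
argmax zero    f = 0 , z≤n , λ { .zero z≤n → ≤-refl }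
argmax (suc m) f with argmax m f
... | t , t≤m , max with f t ≤? f (suc m)
...   | yes ft≤fm = suc m , ≤-refl , λ s s≤ →
  [ (λ s<1+m → ≤-trans (max s (m<1+n⇒m≤n s<1+m)) ft≤fm) , (λ { refl → ≤-refl }) ]′ (m≤n⇒m<n∨m≡n s≤)
...   | no  ft≰fm = t , m≤n⇒m≤1+n t≤m , λ s s≤ →
  [ (λ s<1+m → max s (m<1+n⇒m≤n s<1+m)) , (λ { refl → ≰⇒≥ ft≰fm }) ]′ (m≤n⇒m<n∨m≡n s≤)

cycle-neighbours : ∀ {n} {E : EdgeRel n} → (∀ i j → E i j ≡ E j i) →
  ∀ m → 3 ≤ m → (c : ℕ → Fin n) →
  (∀ i → suc i < m → E (c i) (c (suc i)) ≡ true) → E (c (m ∸ 1)) (c 0) ≡ true →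
  ∀ t → t < m → ∃ λ a → ∃ λ b → a < m × b < m × a ≢ b ×
    E (c t) (c a) ≡ true × E (c t) (c b) ≡ true
cycle-neighbours E-sym (suc (suc (suc k))) (s≤s (s≤s (s≤s _))) c cons close zero _ =
  1 , suc (suc k) , s≤s (s≤s z≤n) , ≤-refl , (λ ()) , cons 0 (s≤s (s≤s z≤n)) , trans (E-sym _ _) close
cycle-neighbours {E = E} E-sym m@(suc (suc (suc k))) (s≤s (s≤s (s≤s _))) c cons close (suc s) t<m
  with suc (suc s) <? m
... | yes t+1<m = suc (suc s) , s , t+1<m , <-trans (n<1+n s) t<m , (λ ())
                , cons (suc s) t+1<m , trans (E-sym _ _) (cons s t<m)
... | no  t+1≮m = 0 , s , z<s , <-trans (n<1+n s) t<m , (λ 0≡s → case trans 0≡s (sym last) of λ ())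
                , subst (λ t → E (c (suc t)) (c 0) ≡ true) last close , trans (E-sym _ _) (cons s t<m)
  where
  last : suc k ≡ s
  last = ≤-antisym (s≤s⁻¹ (s≤s⁻¹ (≮⇒≥ t+1≮m))) (s≤s⁻¹ (s≤s⁻¹ t<m))

record RootedTree {n} (G : Graph n) : Set where
  field
    root        : Fin n
    parent      : Fin n → Fin n
    rank        : Fin n → ℕ
    parent-adj  : ∀ v → v ≢ root → adj G v (parent v) ≡ true
    rank-parent : ∀ v → v ≢ root → rank (parent v) < rank v

  edges : EdgeRel n
  edges i j = (not (i == root) ∧ (parent i == j)) ∨ (not (j == root) ∧ (parent j == i))

  edges-sym : ∀ i j → edges i j ≡ edges j i
  edges-sym i j = ∨-comm (not (i == root) ∧ (parent i == j)) _

  edges-cases : ∀ i j → edges i j ≡ true → (i ≢ root × parent i ≡ j) ⊎ (j ≢ root × parent j ≡ i)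
  edges-cases i j e =
    ⊎-map (child ∘ ∧-true) (child ∘ ∧-true) (∨-true {not (i == root) ∧ (parent i == j)} e)
    where
    child : ∀ {k l} → not (k == root) ≡ true × (parent k == l) ≡ true → k ≢ root × parent k ≡ l
    child (k≢root , pk≡l) = (λ { refl → true≢false (==-refl root) (not-true k≢root) }) , ==⇒≡ pk≡l

  edges-false : ∀ i j → (i ≢ root → parent i ≢ j) → (j ≢ root → parent j ≢ i) → edges i j ≡ false
  edges-false i j i↛j j↛i = ¬-not λ e →
    [ (λ (i≢r , pi≡j) → i↛j i≢r pi≡j) , (λ (j≢r , pj≡i) → j↛i j≢r pj≡i) ]′ (edges-cases i j e)

  edges-parent : ∀ v → v ≢ root → edges v (parent v) ≡ true
  edges-parent v v≢root rewrite ==-≢ v≢root | ==-refl (parent v) = refl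

  edges⊆adj : ∀ i j → edges i j ≡ true → adj G i j ≡ true
  edges⊆adj i j e with edges-cases i j e
  ... | inj₁ (i≢root , refl) = parent-adj i i≢root
  ... | inj₂ (j≢root , refl) = trans (Graph.sym G (parent j) j) (parent-adj j j≢root)

  reach-root : ∀ v → Reach edges v root
  reach-root v = go (suc (rank v)) v ≤-refl
    where
    go : ∀ k v → rank v < k → Reach edges v root
    go (suc k) v rv<k with v ≟ root
    ... | yes refl = here
    ... | no v≢root =
      step (edges-parent v v≢root) (go k (parent v) (≤-trans (rank-parent v v≢root) (s≤s⁻¹ rv<k)))

  edges-connected : ConnectedE edges
  edges-connected a b = Reach-++ (reach-root a) (Reach-reverse edges-sym (reach-root b))

  -- A vertex of maximal rank on a cycle would have both of its cycle neighbours as parent.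
  edges-acyclic : ¬ HasCycle edges
  edges-acyclic (suc k , 3≤m , c , injective , cons , close) with argmax k (rank ∘ c)
  ... | t , t≤k , maximal with cycle-neighbours edges-sym (suc k) 3≤m c cons close t (s≤s t≤k)
  ... | a , b , a<m , b<m , a≢b , ta , tb =
    a≢b (injective a b a<m b<m (trans (sym (to-parent a a<m ta)) (to-parent b b<m tb)))
    where
    to-parent : ∀ s → s < suc k → edges (c t) (c s) ≡ true → parent (c t) ≡ c s
    to-parent s s<m e with edges-cases (c t) (c s) e
    ... | inj₁ (_ , pt≡s) = pt≡s
    ... | inj₂ (s≢root , ps≡t) =
      ⊥-elim (<⇒≱ (subst (λ v → rank v < rank (c s)) ps≡t (rank-parent (c s) s≢root))
                  (maximal s (s≤s⁻¹ s<m)))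

  steinerTree : (S : Subset n) → SteinerTree G S
  steinerTree S = record
    { V = ⊤ ; E = edges ; E-sym = edges-sym ; E⊆G = edges⊆adj
    ; E-endsˡ = λ _ _ _ → ∈⊤ ; S⊆V = λ _ → ∈⊤
    ; conn = λ a b _ _ → edges-connected a b ; acyclic = edges-acyclic }

-- Cycles

record Cycle {n} (G : Graph n) (P : Fin n → Bool) : Set where
  field
    length   : ℕ
    long     : 3 ≤ length
    vertex   : ℕ → Fin n
    adjacent : ∀ j → j < length → adj G (vertex j) (vertex (suc j)) ≡ true
    closed   : vertex length ≡ vertex 0
    distinct : ∀ a b → a < length → b < length → vertex (suc a) ≡ vertex (suc b) → a ≡ b
    inside   : ∀ j → P (vertex j) ≡ true

module NonBacktrackingWalk {n} (G : Graph n) (P : Fin n → Bool)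
  (next : ∀ v a → P v ≡ true → Σ (Fin n) λ j → adj G v j ≡ true × j ≢ a × P j ≡ true)
  (w : Fin n) (Pw : P w ≡ true) where

  -- The previous vertex and the current one.
  Position : Set
  Position = Fin n × Σ (Fin n) λ v → P v ≡ true

  advance : Position → Position
  advance (a , v , Pv) = v , proj₁ (next v a Pv) , proj₂ (proj₂ (proj₂ (next v a Pv)))

  position : ℕ → Position
  position zero    = w , w , Pw
  position (suc k) = advance (position k)

  walk : ℕ → Fin n
  walk k = proj₁ (proj₂ (position k))

  walk-inside : ∀ k → P (walk k) ≡ true
  walk-inside k = proj₂ (proj₂ (position k))

  walk-adj : ∀ k → adj G (walk k) (walk (suc k)) ≡ true
  walk-adj k = proj₁ (proj₂ (next (walk k) (proj₁ (position k)) (walk-inside k)))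

  walk-non-backtracking : ∀ k → walk (suc (suc k)) ≢ walk k
  walk-non-backtracking k = proj₁ (proj₂ (proj₂ (next (walk (suc k)) (walk k) (walk-inside (suc k)))))

  Repeats : ℕ → Set
  Repeats J = ∃ λ i → i < J × walk i ≡ walk J

  eventually-repeats : ∃ Repeats
  eventually-repeats with pigeonhole (n<1+n n) (walk ∘ toℕ)
  ... | i , j , i<j , same = toℕ j , toℕ i , i<j , same

  first-repeat : ∀ J → Acc _<_ J → Repeats J →
    ∃ λ J → Repeats J × (∀ J′ → J′ < J → ¬ Repeats J′)
  first-repeat J (acc earlier) rep with anyUpTo? (λ J′ → anyUpTo? (λ i → walk i ≟ walk J′) J′) J
  ... | yes (J′ , J′<J , rep′) = first-repeat J′ (earlier J′<J) rep′
  ... | no none = J , rep , λ J′ J′<J rep′ → none (J′ , J′<J , rep′)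

  -- The first repetition closes a cycle; the walk never steps back, so it has length at least 3.
  module FromFirstRepeat (J i : ℕ) (i<J : i < J) (loop : walk i ≡ walk J)
    (first : ∀ J′ → J′ < J → ¬ Repeats J′) where

    i+m≡J : i + (J ∸ i) ≡ J
    i+m≡J = m+[n∸m]≡n (<⇒≤ i<J)

    no-repeat : ∀ p q → i < p → p < q → q ≤ J → walk p ≢ walk q
    no-repeat p q i<p p<q q≤J same with m≤n⇒m<n∨m≡n q≤J
    ... | inj₁ q<J = first q q<J (p , p<q , same)
    ... | inj₂ refl = first p p<q (i , i<p , trans loop (sym same))

    long : ∀ m → i + m ≡ J → 3 ≤ m
    long zero e = ⊥-elim (<⇒≢ i<J (trans (sym (+-identityʳ i)) e))
    long (suc zero) e = ⊥-elim (true≢false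
      (subst (λ v → adj G (walk i) v ≡ true) (trans (cong walk (trans (+-comm 1 i) e)) (sym loop))
             (walk-adj i))
      (irrefl G (walk i)))
    long (suc (suc zero)) e =
      ⊥-elim (walk-non-backtracking i (trans (cong walk (trans (+-comm 2 i) e)) (sym loop)))
    long (suc (suc (suc m))) e = s≤s (s≤s (s≤s z≤n))

    cycle : Cycle G P
    cycle = record
      { length   = J ∸ i
      ; long     = long (J ∸ i) i+m≡J
      ; vertex   = λ k → walk (i + k)
      ; adjacent = λ j _ →
          subst (λ k → adj G (walk (i + j)) (walk k) ≡ true) (sym (+-suc i j)) (walk-adj (i + j))
      ; closed   = trans (cong walk i+m≡J) (trans (sym loop) (cong walk (sym (+-identityʳ i))))
      ; distinct = distinct
      ; inside   = λ k → walk-inside (i + k) }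
      where
      inner : ∀ a b → a < b → b < J ∸ i → walk (i + suc a) ≢ walk (i + suc b)
      inner a b a<b b<m = no-repeat (i + suc a) (i + suc b) (m<m+n i z<s) (+-monoʳ-< i (s≤s a<b))
        (≤-trans (+-monoʳ-≤ i b<m) (≤-reflexive i+m≡J))
      distinct : ∀ a b → a < J ∸ i → b < J ∸ i → walk (i + suc a) ≡ walk (i + suc b) → a ≡ b
      distinct a b a<m b<m same with <-cmp a b
      ... | tri< a<b _ _ = ⊥-elim (inner a b a<b b<m same)
      ... | tri≈ _ a≡b _ = a≡b
      ... | tri> _ _ b<a = ⊥-elim (inner b a b<a a<m (sym same))

  cycle : Cycle G P
  cycle with eventually-repeats
  ... | J₀ , rep₀ with first-repeat J₀ (<-wellFounded J₀) rep₀
  ... | J , (i , i<J , loop) , first = FromFirstRepeat.cycle J i i<J loop first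

find-cycle : ∀ {n} (G : Graph n) (P : Fin n → Bool) →
  (∀ v a → P v ≡ true → Σ (Fin n) λ j → adj G v j ≡ true × j ≢ a × P j ≡ true) →
  ∀ w → P w ≡ true → Cycle G P
find-cycle G P next w Pw = NonBacktrackingWalk.cycle G P next w Pw

-- Growing a tree from the root

record PartialTree {n} (H : EdgeRel n) (r : Fin n) : Set where
  field
    done        : Fin n → Bool
    parent      : Fin n → Fin n
    rank        : Fin n → ℕ
    root-done   : done r ≡ true
    parent-done : ∀ v → done v ≡ true → v ≢ r → done (parent v) ≡ true
    parent-edge : ∀ v → done v ≡ true → v ≢ r → H v (parent v) ≡ true
    rank-parent : ∀ v → done v ≡ true → v ≢ r → rank (parent v) < rank v
open PartialTree

module _ {n} {H : EdgeRel n} {r : Fin n} where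

  attach : (T : PartialTree H r) (w b : Fin n) → done T w ≡ false → done T b ≡ true → H w b ≡ true →
    PartialTree H r
  attach T w b w-undone b-done w~b = record
    { done        = λ v → done T v ∨ (v == w)
    ; parent      = parent′
    ; rank        = rank′
    ; root-done   = ∨-introˡ _ (root-done T)
    ; parent-done = parent-done′
    ; parent-edge = parent-edge′
    ; rank-parent = rank-parent′ }
    where
    parent′ : Fin n → Fin n
    parent′ v = if v == w then b else parent T v
    rank′ : Fin n → ℕ
    rank′ v = if v == w then suc (rank T b) else rank T v

    rank-unchanged : ∀ {v} → done T v ≡ true → rank′ v ≡ rank T v
    rank-unchanged {v} v-done =
      cong (λ b → if b then _ else rank T v) (==-≢ (true-false⇒≢ {P = done T} v-done w-undone))

    parent-done′ : ∀ v → (done T v ∨ (v == w)) ≡ true → v ≢ r →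
      (done T (parent′ v) ∨ (parent′ v == w)) ≡ true
    parent-edge′ : ∀ v → (done T v ∨ (v == w)) ≡ true → v ≢ r → H v (parent′ v) ≡ true
    rank-parent′ : ∀ v → (done T v ∨ (v == w)) ≡ true → v ≢ r → rank′ (parent′ v) < rank′ v
    parent-done′ v v-done v≢r with v ≟ w
    ... | yes refl = ∨-introˡ _ b-done
    ... | no v≢w = ∨-introˡ _ (parent-done T v (∨-false-elim v-done) v≢r)
    parent-edge′ v v-done v≢r with v ≟ w
    ... | yes refl = w~b
    ... | no v≢w = parent-edge T v (∨-false-elim v-done) v≢r
    rank-parent′ v v-done v≢r with v ≟ w
    ... | yes refl = subst (_< suc (rank T b)) (sym (rank-unchanged b-done)) ≤-refl
    ... | no v≢w = subst (_< rank T v) (sym (rank-unchanged (parent-done T v (∨-false-elim v-done) v≢r)))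
                         (rank-parent T v (∨-false-elim v-done) v≢r)

  retarget : ∀ {H′ : EdgeRel n} (T : PartialTree H r) →
    (∀ i j → done T i ≡ true → done T j ≡ true → H i j ≡ true → H′ i j ≡ true) → PartialTree H′ r
  retarget T H⇒H′ = record
    { done = done T ; parent = parent T ; rank = rank T
    ; root-done = root-done T ; parent-done = parent-done T ; rank-parent = rank-parent T
    ; parent-edge = λ v v-done v≢r →
        H⇒H′ v (parent T v) v-done (parent-done T v v-done v≢r) (parent-edge T v v-done v≢r) }

  attach-path : (T : PartialTree H r) (p : ℕ → Fin n) (L : ℕ) →
    done T (p 0) ≡ true →
    (∀ j → j < L → done T (p (suc j)) ≡ false) →
    (∀ a b → a < L → b < L → p (suc a) ≡ p (suc b) → a ≡ b) →
    (∀ j → j < L → H (p (suc j)) (p j) ≡ true) →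
    ∀ l → l ≤ L → Σ (PartialTree H r) λ T′ →
      (∀ v → done T v ≡ true → done T′ v ≡ true) × (∀ j → j ≤ l → done T′ (p j) ≡ true) ×
      (∀ v → done T′ v ≡ true → done T v ≡ true ⊎ ∃ λ j → j < l × v ≡ p (suc j))
  attach-path T p L p₀-done undone injective path zero _ =
    T , (λ _ v-done → v-done) , (λ { .zero z≤n → p₀-done }) , (λ _ → inj₁)
  attach-path T p L p₀-done undone injective path (suc l) l<L
    with attach-path T p L p₀-done undone injective path l (<⇒≤ l<L)
  ... | T′ , grows , on-path , only-path =
    attach T′ (p (suc l)) (p l) next-undone (on-path l ≤-refl) (path l l<L) ,
    (λ v v-done → ∨-introˡ _ (grows v v-done)) , on-path′ , only-path′
    where
    next-undone : done T′ (p (suc l)) ≡ false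
    next-undone = ¬-not λ next-done → case only-path (p (suc l)) next-done of λ where
      (inj₁ was-done)          → true≢false was-done (undone l l<L)
      (inj₂ (j , j<l , same)) → <⇒≢ j<l (sym (injective l j l<L (<-trans j<l l<L) same))
    on-path′ : ∀ j → j ≤ suc l → (done T′ (p j) ∨ (p j == p (suc l))) ≡ true
    on-path′ j j≤ with m≤n⇒m<n∨m≡n j≤
    ... | inj₁ j<  = ∨-introˡ _ (on-path j (s≤s⁻¹ j<))
    ... | inj₂ refl = ∨-introʳ _ (==-refl (p (suc l)))
    only-path′ : ∀ v → (done T′ v ∨ (v == p (suc l))) ≡ true →
      done T v ≡ true ⊎ ∃ λ j → j < suc l × v ≡ p (suc j)
    only-path′ v v-done with ∨-true v-done
    ... | inj₂ is-next = inj₂ (l , ≤-refl , ==⇒≡ is-next)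
    ... | inj₁ was-done with only-path v was-done
    ...   | inj₁ old = inj₁ old
    ...   | inj₂ (j , j<l , same) = inj₂ (j , m<n⇒m<1+n j<l , same)

  toRootedTree : ∀ {G : Graph n} (T : PartialTree H r) → (∀ v → done T v ≡ true) →
    (∀ i j → H i j ≡ true → adj G i j ≡ true) → RootedTree G
  toRootedTree T all-done H⊆G = record
    { root = r ; parent = parent T ; rank = rank T
    ; parent-adj  = λ v v≢r → H⊆G v (parent T v) (parent-edge T v (all-done v) v≢r)
    ; rank-parent = λ v → rank-parent T v (all-done v) }

  toRootedTree-edges : ∀ {G : Graph n} (T : PartialTree H r) (all-done : ∀ v → done T v ≡ true)
    (H⊆G : ∀ i j → H i j ≡ true → adj G i j ≡ true) → (∀ i j → H i j ≡ H j i) →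
    ∀ i j → RootedTree.edges (toRootedTree {G = G} T all-done H⊆G) i j ≡ true → H i j ≡ true
  toRootedTree-edges {G} T all-done H⊆G H-sym i j e
    with RootedTree.edges-cases (toRootedTree {G = G} T all-done H⊆G) i j e
  ... | inj₁ (i≢r , refl) = parent-edge T i (all-done i) i≢r
  ... | inj₂ (j≢r , refl) = trans (H-sym (parent T j) j) (parent-edge T j (all-done j) j≢r)

-- Two edge-disjoint spanning trees

removeEdges-sym : ∀ {n} (G : Graph n) (F : EdgeRel n) → (∀ i j → F i j ≡ F j i) →
  ∀ i j → removeEdges G F i j ≡ removeEdges G F j i
removeEdges-sym G F F-sym i j rewrite Graph.sym G i j | F-sym i j = refl

module TwoSpanningTrees {n} (G : Graph n) (u : Fin n)
  (u-universal : ∀ v → v ≢ u → adj G u v ≡ true)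
  (avoid : ∀ v a → v ≢ u → ∃ λ j → adj G v j ≡ true × j ≢ u × j ≢ a) where

  adj-u : ∀ v → v ≢ u → adj G v u ≡ true
  adj-u v v≢u = trans (Graph.sym G v u) (u-universal v v≢u)

  record Rerouting : Set where
    field
      rerouted    : Fin n → Bool
      target      : Fin n → Fin n
      u-kept      : rerouted u ≡ false
      target-kept : ∀ x → rerouted x ≡ true → rerouted (target x) ≡ false
      target≢u    : ∀ x → rerouted x ≡ true → target x ≢ u
      target-adj  : ∀ x → rerouted x ≡ true → adj G x (target x) ≡ true

    parent₁ : Fin n → Fin n
    parent₁ v = if rerouted v then target v else u

    rank₁ : Fin n → ℕ
    rank₁ v = if v == u then 0 else if rerouted v then 2 else 1

    tree₁ : RootedTree G
    tree₁ = record
      { root = u ; parent = parent₁ ; rank = rank₁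
      ; parent-adj = parent-adj₁ ; rank-parent = rank-parent₁ }
      where
      parent-adj₁ : ∀ v → v ≢ u → adj G v (parent₁ v) ≡ true
      parent-adj₁ v v≢u with rerouted v in rv
      ... | true  = target-adj v rv
      ... | false = adj-u v v≢u
      rank-parent₁ : ∀ v → v ≢ u → rank₁ (parent₁ v) < rank₁ v
      rank-parent₁ v v≢u rewrite ==-≢ v≢u with rerouted v in rv
      ... | true  rewrite ==-≢ (target≢u v rv) | target-kept v rv = ≤-refl
      ... | false rewrite ==-refl u = ≤-refl

    coTree : EdgeRel n
    coTree = removeEdges G (RootedTree.edges tree₁)

    coTree⊆adj : ∀ i j → coTree i j ≡ true → adj G i j ≡ true
    coTree⊆adj i j e = proj₁ (∧-true e)

    coTree-sym : ∀ i j → coTree i j ≡ coTree j i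
    coTree-sym = removeEdges-sym G _ (RootedTree.edges-sym tree₁)

    coTree-edge : ∀ w b → adj G w b ≡ true → (w ≢ u → parent₁ w ≢ b) → (b ≢ u → parent₁ b ≢ w) →
      coTree w b ≡ true
    coTree-edge w b w~b w↛b b↛w rewrite w~b | RootedTree.edges-false tree₁ w b w↛b b↛w = refl

    coTree-edge-unrerouted : ∀ w b → adj G w b ≡ true → w ≢ u → b ≢ u → rerouted w ≡ false →
      (rerouted b ≡ true → target b ≢ w) → coTree w b ≡ true
    coTree-edge-unrerouted w b w~b w≢u b≢u rw≡false b↛w = coTree-edge w b w~b
      (λ _ → subst (_≢ b) (sym (cong (λ r → if r then target w else u) rw≡false)) (b≢u ∘ sym))
      (λ _ → b↛w′)
      where
      b↛w′ : parent₁ b ≢ w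
      b↛w′ with rerouted b
      ... | true  = b↛w refl
      ... | false = w≢u ∘ sym

  open Rerouting

  -- target-reached ensures that an edge from an unreached vertex to a reached one never lies in tree₁.
  record State (R : Rerouting) : Set where
    field
      tree₂            : PartialTree (coTree R) u
      rerouted-reached : ∀ x → rerouted R x ≡ true → done tree₂ x ≡ true
      target-reached   : ∀ x → rerouted R x ≡ true → done tree₂ (target R x) ≡ true

    reached unreached : Fin n → Bool
    reached = done tree₂
    unreached v = not (reached v)

    unreached≢u : ∀ {v} → reached v ≡ false → v ≢ u
    unreached≢u v-unreached refl = true≢false (root-done tree₂) v-unreached

    unreached-unrerouted : ∀ {v} → reached v ≡ false → rerouted R v ≡ false
    unreached-unrerouted v-unreached = ¬-not λ rv → true≢false (rerouted-reached _ rv) v-unreached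

  open State

  initial : State record
    { rerouted = λ _ → false ; target = id
    ; u-kept = refl ; target-kept = λ _ () ; target≢u = λ _ () ; target-adj = λ _ () }
  initial = record
    { tree₂ = record
      { done = _== u ; parent = id ; rank = λ _ → 0 ; root-done = ==-refl u
      ; parent-done = only-u ; parent-edge = only-u ; rank-parent = only-u }
    ; rerouted-reached = λ _ ()
    ; target-reached = λ _ () }
    where
    only-u : ∀ {A : Fin n → Set} v → (v == u) ≡ true → v ≢ u → A v
    only-u v v==u v≢u = ⊥-elim (v≢u (==⇒≡ v==u))

  record Growth {R} (s : State R) : Set where
    field
      R′            : Rerouting
      s′            : State R′
      grows         : ∀ v → reached s v ≡ true → reached s′ v ≡ true
      new           : Fin n
      new-unreached : reached s new ≡ false
      new-reached   : reached s′ new ≡ true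

    fewer-unreached : count (unreached s′) < count (unreached s)
    fewer-unreached = count-mono-< still-unreached new (cong not new-reached) (cong not new-unreached)
      where
      still-unreached : ∀ v → unreached s′ v ≡ true → unreached s v ≡ true
      still-unreached v v-unreached′ =
        cong not (¬-not λ v-reached → true≢false (grows v v-reached) (not-true v-unreached′))

  attach-growth : ∀ {R} (s : State R) w b → reached s w ≡ false → reached s b ≡ true → b ≢ u →
    adj G w b ≡ true → Growth s
  attach-growth {R} s w b w-unreached b-reached b≢u w~b = record
    { R′ = R
    ; s′ = record
      { tree₂ = attach (tree₂ s) w b w-unreached b-reached
          (coTree-edge-unrerouted R w b w~b (unreached≢u s w-unreached) b≢u
             (unreached-unrerouted s w-unreached)
             λ rb → true-false⇒≢ {P = reached s} (target-reached s b rb) w-unreached)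
      ; rerouted-reached = λ x rx → ∨-introˡ _ (rerouted-reached s x rx)
      ; target-reached = λ x rx → ∨-introˡ _ (target-reached s x rx) }
    ; grows = λ v v-reached → ∨-introˡ _ v-reached
    ; new = w ; new-unreached = w-unreached ; new-reached = ∨-introʳ _ (==-refl w) }

  -- With x = c 1 rerouted to y = c 0, the path u, c 1, …, c L = y runs through co-tree edges.
  module Ear {R} (s : State R) (C : Cycle G (unreached s)) where
    open Cycle C renaming (vertex to c; length to L)

    c-unreached : ∀ j → reached s (c j) ≡ false
    c-unreached j = not-true (inside j)

    c≢u : ∀ j → c j ≢ u
    c≢u j = unreached≢u s (c-unreached j)

    0<L : 0 < L
    0<L = ≤-trans (s≤s z≤n) long

    L≡1+L′ : L ≡ suc (L ∸ 1)
    L≡1+L′ = sym (m+[n∸m]≡n 0<L)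

    x y : Fin n
    x = c 1
    y = c 0

    reached≢x : ∀ {v} → reached s v ≡ true → v ≢ x
    reached≢x v-reached = true-false⇒≢ {P = reached s} v-reached (c-unreached 1)

    x~y : adj G x y ≡ true
    x~y = trans (Graph.sym G x y) (adjacent 0 0<L)

    y≢x : y ≢ x
    y≢x y≡x = true≢false (subst (λ t → adj G x t ≡ true) y≡x x~y) (irrefl G x)

    c-last : c (suc (L ∸ 1)) ≡ y
    c-last = trans (cong c (sym L≡1+L′)) closed

    inner≢y : ∀ a → suc a < L → c (suc a) ≢ y
    inner≢y a a+1<L same = <⇒≢ (s≤s⁻¹ (subst (suc a <_) L≡1+L′ a+1<L))
      (distinct a (L ∸ 1) (<-trans (n<1+n a) a+1<L) (subst (L ∸ 1 <_) (sym L≡1+L′) ≤-refl)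
                (trans same (sym c-last)))

    inner≢x : ∀ a → a < L → a ≢ 0 → c (suc a) ≢ x
    inner≢x a a<L a≢0 same = a≢0 (distinct a 0 a<L 0<L same)

    rerouted′ : Fin n → Bool
    rerouted′ v = rerouted R v ∨ (v == x)

    target′ : Fin n → Fin n
    target′ v = if v == x then y else target R v

    rerouted′-x : rerouted′ x ≡ true
    rerouted′-x = ∨-introʳ _ (==-refl x)

    rerouted′-old : ∀ {v} → v ≢ x → rerouted′ v ≡ rerouted R v
    rerouted′-old v≢x = trans (cong (rerouted R _ ∨_) (==-≢ v≢x)) (∨-identityʳ _)

    target′-x : target′ x ≡ y
    target′-x = cong (λ b → if b then y else target R x) (==-refl x)

    target′-old : ∀ {v} → v ≢ x → target′ v ≡ target R v
    target′-old {v} v≢x = cong (λ b → if b then y else target R v) (==-≢ v≢x)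

    R′ : Rerouting
    R′ = record
      { rerouted = rerouted′ ; target = target′
      ; u-kept = ∨-false (u-kept R) (==-≢ (c≢u 1 ∘ sym))
      ; target-kept = target-kept′ ; target≢u = target≢u′ ; target-adj = target-adj′ }
      where
      target-kept′ : ∀ v → rerouted′ v ≡ true → rerouted′ (target′ v) ≡ false
      target-kept′ v rv with v ≟ x
      ... | yes refl = trans (rerouted′-old y≢x) (unreached-unrerouted s (c-unreached 0))
      ... | no v≢x = trans (rerouted′-old (reached≢x (target-reached s v (∨-false-elim rv))))
                           (target-kept R v (∨-false-elim rv))
      target≢u′ : ∀ v → rerouted′ v ≡ true → target′ v ≢ u
      target≢u′ v rv with v ≟ x
      ... | yes refl = c≢u 0
      ... | no v≢x = target≢u R v (∨-false-elim rv)
      target-adj′ : ∀ v → rerouted′ v ≡ true → adj G v (target′ v) ≡ true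
      target-adj′ v rv with v ≟ x
      ... | yes refl = x~y
      ... | no v≢x = target-adj R v (∨-false-elim rv)

    parent₁′-x : parent₁ R′ x ≡ y
    parent₁′-x = cong₂ (λ b t → if b then t else u) rerouted′-x target′-x

    parent₁′-old : ∀ {v} → v ≢ x → parent₁ R′ v ≡ parent₁ R v
    parent₁′-old v≢x = cong₂ (λ b t → if b then t else u) (rerouted′-old v≢x) (target′-old v≢x)

    coTree-agree : ∀ i j → i ≢ x → j ≢ x → coTree R′ i j ≡ coTree R i j
    coTree-agree i j i≢x j≢x =
      cong₂ (λ p q → adj G i j ∧ not ((not (i == u) ∧ (p == j)) ∨ (not (j == u) ∧ (q == i))))
        (parent₁′-old i≢x) (parent₁′-old j≢x)

    path : ℕ → Fin n
    path zero    = u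
    path (suc j) = c (suc j)

    path-edge : ∀ j → j < L → coTree R′ (path (suc j)) (path j) ≡ true
    path-edge zero _ = coTree-edge R′ x u (adj-u x (c≢u 1))
      (λ _ → subst (_≢ u) (sym parent₁′-x) (c≢u 0)) (λ u≢u → ⊥-elim (u≢u refl))
    path-edge (suc k) k+1<L = coTree-edge-unrerouted R′ (c (suc (suc k))) (c (suc k))
      (trans (Graph.sym G _ _) (adjacent (suc k) k+1<L)) (c≢u _) (c≢u _)
      (trans (rerouted′-old (inner≢x (suc k) k+1<L λ ())) (unreached-unrerouted s (c-unreached _)))
      k+1↛k+2
      where
      k+1↛k+2 : rerouted′ (c (suc k)) ≡ true → target′ (c (suc k)) ≢ c (suc (suc k))
      k+1↛k+2 rk with c (suc k) ≟ x
      ... | no k+1≢x =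
        ⊥-elim (true≢false (∨-false-elim rk) (unreached-unrerouted s (c-unreached (suc k))))
      ... | yes k+1≡x with distinct k 0 (<-trans (n<1+n k) k+1<L) 0<L k+1≡x
      ...   | refl = λ y≡c2 → inner≢y 1 long (sym y≡c2)

    coTree-kept : ∀ i j → reached s i ≡ true → reached s j ≡ true →
      coTree R i j ≡ true → coTree R′ i j ≡ true
    coTree-kept i j i-reached j-reached =
      trans (coTree-agree i j (reached≢x i-reached) (reached≢x j-reached))

    growth : Growth s
    growth with attach-path (retarget (tree₂ s) coTree-kept) path L (root-done (tree₂ s))
                  (λ j _ → c-unreached (suc j)) distinct path-edge L ≤-refl
    ... | T′ , grows , on-path , _ = record
      { R′ = R′
      ; s′ = record { tree₂ = T′ ; rerouted-reached = rerouted-reached′ ; target-reached = target-reached′ }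
      ; grows = grows
      ; new = x ; new-unreached = c-unreached 1 ; new-reached = on-path 1 0<L }
      where
      rerouted-reached′ : ∀ v → rerouted′ v ≡ true → done T′ v ≡ true
      rerouted-reached′ v rv with v ≟ x
      ... | yes refl = on-path 1 0<L
      ... | no v≢x = grows v (rerouted-reached s v (∨-false-elim rv))
      target-reached′ : ∀ v → rerouted′ v ≡ true → done T′ (target′ v) ≡ true
      target-reached′ v rv with v ≟ x
      ... | yes refl =
        subst (λ t → done T′ t ≡ true) c-last (on-path (suc (L ∸ 1)) (≤-reflexive (sym L≡1+L′)))
      ... | no v≢x = grows _ (target-reached s v (∨-false-elim rv))

  Attachable : ∀ {R} → State R → Set
  Attachable s = ∃ λ w → ∃ λ b → reached s w ≡ false × reached s b ≡ true × b ≢ u × adj G w b ≡ true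

  attachable? : ∀ {R} (s : State R) → Dec (Attachable s)
  attachable? s = any? λ w → any? λ b →
    (reached s w ≟ᵇ false) ×-dec (reached s b ≟ᵇ true) ×-dec ¬? (b ≟ u) ×-dec (adj G w b ≟ᵇ true)

  grow : ∀ {R} (s : State R) w₀ → reached s w₀ ≡ false → Growth s
  grow s w₀ w₀-unreached with attachable? s
  ... | yes (w , b , w-unreached , b-reached , b≢u , w~b) =
    attach-growth s w b w-unreached b-reached b≢u w~b
  ... | no stuck = Ear.growth s (find-cycle G (unreached s) next w₀ (cong not w₀-unreached))
    where
    next : ∀ v a → unreached s v ≡ true →
      Σ (Fin n) λ j → adj G v j ≡ true × j ≢ a × unreached s j ≡ true
    next v a v-unreached with avoid v a (unreached≢u s (not-true v-unreached))
    ... | j , v~j , j≢u , j≢a =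
      j , v~j , j≢a ,
      cong not (¬-not λ j-reached → stuck (v , j , not-true v-unreached , j-reached , j≢u , v~j))

  grow-all : ∀ k {R} (s : State R) → count (unreached s) ≤ k →
    Σ Rerouting λ R′ → Σ (State R′) λ s′ → ∀ v → reached s′ v ≡ true
  grow-all k {R} s bound with any? (λ w → reached s w ≟ᵇ false)
  ... | no none = R , s , λ v → ¬-not λ v-unreached → none (v , v-unreached)
  ... | yes (w₀ , w₀-unreached) with grow s w₀ w₀-unreached | k
  ...   | g | zero  = ⊥-elim (n≮0 (≤-trans (Growth.fewer-unreached g) bound))
  ...   | g | suc k = grow-all k (Growth.s′ g) (s≤s⁻¹ (≤-trans (Growth.fewer-unreached g) bound))

  two-spanning-trees : Σ (RootedTree G) λ T₁ → Σ (RootedTree G) λ T₂ →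
    ∀ i j → RootedTree.edges T₁ i j ≡ true → RootedTree.edges T₂ i j ≡ false
  two-spanning-trees with grow-all n initial (count≤n (unreached initial))
  ... | R , s , all-reached = tree₁ R , T₂ , disjoint
    where
    T₂ : RootedTree G
    T₂ = toRootedTree (tree₂ s) all-reached (coTree⊆adj R)
    T₂⊆coTree : ∀ i j → RootedTree.edges T₂ i j ≡ true → coTree R i j ≡ true
    T₂⊆coTree = toRootedTree-edges {G = G} (tree₂ s) all-reached (coTree⊆adj R) (coTree-sym R)
    disjoint : ∀ i j → RootedTree.edges (tree₁ R) i j ≡ true → RootedTree.edges T₂ i j ≡ false
    disjoint i j e₁ = ¬-not λ e₂ → true≢false e₁ (not-true (proj₂ (∧-true (T₂⊆coTree i j e₂))))

packing-from-spanning-trees : ∀ {n} {G : Graph n} (T₁ T₂ : RootedTree G) →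
  (∀ i j → RootedTree.edges T₁ i j ≡ true → RootedTree.edges T₂ i j ≡ false) →
  ∀ S → SteinerPackingAtLeast G S 2
packing-from-spanning-trees T₁ T₂ disjoint S = trees , pairwise
  where
  trees : Fin 2 → SteinerTree _ S
  trees zero       = RootedTree.steinerTree T₁ S
  trees (suc zero) = RootedTree.steinerTree T₂ S
  pairwise : ∀ a b → a ≢ b → EdgeDisjoint (trees a) (trees b)
  pairwise zero       zero       a≢b = ⊥-elim (a≢b refl)
  pairwise zero       (suc zero) _   = disjoint
  pairwise (suc zero) zero       _   = λ i j e₂ → ¬-not λ e₁ → true≢false e₂ (disjoint i j e₁)
  pairwise (suc zero) (suc zero) a≢b = ⊥-elim (a≢b refl)

-- The trees span G.
lemma5 : ∀ {n : ℕ} (G : Graph n) → Connected G → EdgeConnectivityIs G 3 →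
    (u : Fin n) → degree G u ≡ n ∸ 1 →
    ∀ (k : ℕ) → 3 ≤ k → k ≤ n → GenEdgeConnAtLeast G k 2
lemma5 G connected (λ≥3 , _) u deg _ _ _ with TwoSpanningTrees.two-spanning-trees G u
    (degree≡n∸1⇒adj G u deg) (λ v a v≢u → neighbour-avoiding G λ≥3 v u a v≢u)
... | T₁ , T₂ , disjoint = connected , λ S _ → packing-from-spanning-trees T₁ T₂ disjoint S
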